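{- After the decomposition algorithm terminates, the total number of refined segments in $\mathrm{RS}[1],\dots,\mathrm{RS}[h]$ equals the number of canonical refined segments plus the total number of haplotype intervals (over all haplotypes).
   Context: Setting: haplotypes $S_1,\dots,S_h$ of length $m$; prefix array $\mathrm{PA}$ ($h\times m$, column $1$ is $1,\dots,h$, column $j>1$ sorts indices by co-lexicographic order of $S_i[1..j-1]$, ties broken stably); PBWT with $\mathrm{col}_j(\mathrm{PBWT})[x]=S_{\mathrm{col}_j(\mathrm{PA})[x]}[j]$; $(x,j)$ is a run-top if $x=1$ or $\mathrm{col}_j(\mathrm{PBWT})[x]\ne\mathrm{col}_j(\mathrm{PBWT})[x-1]$. Haplotype intervals of $S_i$: with $b_1<\dots<b_k=m$ the set of $m$ and all columns $j$ such that some run-top $(x,j)$ has $\mathrm{col}_j(\mathrm{PA})[x]=i$, they are $[1,b_1],[b_1+1,b_2],\dots,[b_{k-1}+1,b_k]$. Two intervals overlap if they share an integer. Decomposition algorithm with integer parameter $d>1$: initially, for each $c$, $L_c$ is the linked list of haplotype intervals of $S_c$ in increasing order and $\mathrm{RS}[c]$ is empty. For $j=1,\dots,m$ and, within each $j$, for $i=1,\dots,h$: let $c=\mathrm{col}_j(\mathrm{PA})[i]$ and let $[b_c,e_c]$ be the first interval of $L_c$. If $j=e_c$, remove $[b_c,e_c]$ from $L_c$ and append it to the tail of $\mathrm{RS}[c]$ (Passive Split). Otherwise, if $i>1$ and $[b_c,j]$ overlaps exactly $d$ refined segments currently in $\mathrm{RS}[c']$, where $c'=\mathrm{col}_j(\mathrm{PA})[i-1]$,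 append $[b_c,j]$ to $\mathrm{RS}[c]$ and replace the head $[b_c,e_c]$ of $L_c$ by $[j+1,e_c]$ (Active Split). Intervals in the lists $\mathrm{RS}[\cdot]$ are called refined segments. A refined segment is canonical if it was produced by an Active Split step, and non-canonical otherwise. -}

module Defs where

open import Data.Nat using (ℕ; zero; suc; _+_; _∸_; _<?_; _<ᵇ_; _≡ᵇ_; _≤ᵇ_)
open import Data.Fin using (Fin; toℕ; fromℕ<)
open import Data.Fin.Properties using () renaming (_≟_ to _≟F_)
open import Data.Bool using (Bool; true; false; _∨_; _∧_; if_then_else_)
open import Data.List using (List; []; _∷_; _++_; [_]; map; reverse; foldr; foldl; length; upTo; allFin; filterᵇ)
open import Data.Nat.ListAction using (sum)
open import Data.Bool.ListAction using (any)
open import Data.Maybe using (Maybe; just; nothing)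
open import Data.Product using (_×_; _,_)
open import Relation.Nullary using (yes; no)
open import Relation.Nullary.Decidable using (⌊_⌋)

-- h haplotypes S_1..S_h (indexed by Fin h, i.e. 0-based haplotype indices),
-- each of length m over the alphabet ℕ (S i k = S_{i+1}[k+1]).
Haplotypes : ℕ → ℕ → Set
Haplotypes h m = Fin h → Fin m → ℕ

-- 1-based access S_i[j] for columns j ∈ 1..m (0 outside, never used there)
sym : ∀ {h m} → Haplotypes h m → Fin h → ℕ → ℕ
sym S i zero = 0
sym {m = m} S i (suc k) with k <? m
... | yes p = S i (fromℕ< p)
... | no _  = 0

range : ℕ → ℕ → List ℕ
range a n = map (a +_) (upTo n)

lexLt : List ℕ → List ℕ → Bool
lexLt [] [] = false
lexLt [] (_ ∷ _) = true
lexLt (_ ∷ _) [] = false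
lexLt (a ∷ as) (b ∷ bs) = (a <ᵇ b) ∨ ((a ≡ᵇ b) ∧ lexLt as bs)

eqList : List ℕ → List ℕ → Bool
eqList [] [] = true
eqList [] (_ ∷ _) = false
eqList (_ ∷ _) [] = false
eqList (a ∷ as) (b ∷ bs) = (a ≡ᵇ b) ∧ eqList as bs

-- reversed prefix S_i[1..j-1] (reversal turns co-lex order into lex order)
revPrefix : ∀ {h m} → Haplotypes h m → ℕ → Fin h → List ℕ
revPrefix S j i = reverse (map (sym S i) (range 1 (j ∸ 1)))

-- i comes strictly before i' in column j of PA: co-lex smaller prefix,
-- ties (equal prefixes) broken by original index (stable order)
before : ∀ {h m} → Haplotypes h m → ℕ → Fin h → Fin h → Bool
before S j i i' =
  lexLt (revPrefix S j i) (revPrefix S j i')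
  ∨ (eqList (revPrefix S j i) (revPrefix S j i') ∧ (toℕ i <ᵇ toℕ i'))

insertBy : {A : Set} → (A → A → Bool) → A → List A → List A
insertBy lt x [] = x ∷ []
insertBy lt x (y ∷ ys) = if lt x y then x ∷ y ∷ ys else y ∷ insertBy lt x ys

sortBy : {A : Set} → (A → A → Bool) → List A → List A
sortBy lt = foldr (insertBy lt) []

-- col_j(PA), listed from row 1 to row h
PAcol : ∀ {h m} → Haplotypes h m → ℕ → List (Fin h)
PAcol {h} S j = sortBy (before S j) (allFin h)

-- haplotypes at run-tops of a column: given v c = col_j(PBWT) value of row holding c
runTopsGo : ∀ {h} → (Fin h → ℕ) → Fin h → List (Fin h) → List (Fin h)
runTopsGo v p [] = []
runTopsGo v p (c ∷ cs) =
  if v c ≡ᵇ v p then runTopsGo v c cs else c ∷ runTopsGo v c cs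

runTops : ∀ {h} → (Fin h → ℕ) → List (Fin h) → List (Fin h)
runTops v [] = []
runTops v (c ∷ cs) = c ∷ runTopsGo v c cs

isRunTopOf : ∀ {h m} → Haplotypes h m → ℕ → Fin h → Bool
isRunTopOf S j i = any (λ c → ⌊ c ≟F i ⌋) (runTops (λ c → sym S c j) (PAcol S j))

boundaries : ∀ {h m} → Haplotypes h m → Fin h → List ℕ
boundaries {m = m} S i = filterᵇ (λ j → (j ≡ᵇ m) ∨ isRunTopOf S j i) (range 1 m)

mkIntervals : ℕ → List ℕ → List (ℕ × ℕ)
mkIntervals s [] = []
mkIntervals s (b ∷ bs) = (s , b) ∷ mkIntervals (suc b) bs

hapIntervals : ∀ {h m} → Haplotypes h m → Fin h → List (ℕ × ℕ)
hapIntervals S i = mkIntervals 1 (boundaries S i)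

totalHapIntervals : ∀ {h m} → Haplotypes h m → ℕ
totalHapIntervals {h} S = sum (map (λ i → length (hapIntervals S i)) (allFin h))

-- refined segment [start,end] with flag: produced by Active Split or not
record Seg : Set where
  constructor seg
  field
    start : ℕ
    end : ℕ
    canonical : Bool
open Seg public

overlaps : ℕ × ℕ → ℕ × ℕ → Bool
overlaps (a , b) (a' , b') = (a ≤ᵇ b) ∧ (a' ≤ᵇ b') ∧ (a ≤ᵇ b') ∧ (a' ≤ᵇ b)

record State (h : ℕ) : Set where
  constructor st
  field
    L  : Fin h → List (ℕ × ℕ)
    RS : Fin h → List Seg
open State public

update : ∀ {h} {A : Set} → (Fin h → A) → Fin h → A → Fin h → A
update f c v c' = if ⌊ c' ≟F c ⌋ then v else f c'

countOverlaps : ℕ × ℕ → List Seg → ℕ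
countOverlaps I rs = length (filterᵇ (λ s → overlaps I (start s , end s)) rs)

-- one step: row i (prev = haplotype in row i-1, nothing if i = 1), c = col_j(PA)[i]
step : ∀ {h} → ℕ → ℕ → Maybe (Fin h) → Fin h → State h → State h
step d j prev c s with L s c
... | [] = s
... | (b , e) ∷ rest =
  if j ≡ᵇ e
  then st (update (L s) c rest) (update (RS s) c (RS s c ++ [ seg b e false ]))
  else activeCase prev
  where
  activeCase : Maybe _ → State _
  activeCase nothing = s
  activeCase (just c') =
    if countOverlaps (b , j) (RS s c') ≡ᵇ d
    then st (update (L s) c ((suc j , e) ∷ rest))
            (update (RS s) c (RS s c ++ [ seg b j true ]))
    else s

runRows : ∀ {h} → ℕ → ℕ → Maybe (Fin h) → List (Fin h) → State h → State h
runRows d j prev [] s = s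
runRows d j prev (c ∷ cs) s = runRows d j (just c) cs (step d j prev c s)

initState : ∀ {h m} → Haplotypes h m → State h
initState S = st (hapIntervals S) (λ _ → [])

decompose : ∀ {h m} → Haplotypes h m → ℕ → State h
decompose {m = m} S d =
  foldl (λ s j → runRows d j nothing (PAcol S j) s) (initState S) (range 1 m)

totalRefined : ∀ {h} → State h → ℕ
totalRefined {h} s = sum (map (λ c → length (RS s c)) (allFin h))

totalCanonical : ∀ {h} → State h → ℕ
totalCanonical {h} s =
  sum (map (λ c → length (filterᵇ canonical (RS s c))) (allFin h))

{-# OPTIONS --safe #-}
module Submission where

-- For every haplotype c the number of non-canonical segments in RS[c] plus the
-- number of intervals still in L_c is the number of haplotype intervals of S_c:
-- a Passive Split moves one interval from L_c to RS[c] as a non-canonical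
-- segment, and an Active Split adds a canonical segment while only shortening
-- the head of L_c.  The ends of the intervals in L_c are strictly increasing
-- and at most m, and after column j they all exceed j, because c occurs in
-- column j of PA and its head interval is then either removed (end j) or has
-- end > j.  Hence every L_c is empty at the end.

open import Defs
open import Data.Nat using (ℕ; _<_; _≤_; _+_)
open import Relation.Binary.PropositionalEquality using (_≡_)

open import Algebra.Properties.CommutativeSemigroup using (interchange)
open import Data.Bool using (Bool; true; false; not)
open import Data.Empty using (⊥-elim)
open import Data.Fin using (Fin)
open import Data.Fin.Properties using () renaming (_≟_ to _≟F_)
open import Data.List using (List; []; _∷_; _++_; [_]; map; foldl; length; filterᵇ; applyUpTo; upTo; allFin)
open import Data.List.Membership.Propositional using (_∈_)
open import Data.List.Membership.Propositional.Properties using (∈-allFin)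
open import Data.List.Properties using (filter-++; length-++; length-map; map-applyUpTo; map-upTo; map-cong)
open import Data.List.Relation.Binary.Permutation.Propositional using (_↭_; ↭-refl; ↭-prep; ↭-swap; ↭-trans; ↭-sym)
open import Data.List.Relation.Binary.Permutation.Propositional.Properties using (∈-resp-↭)
open import Data.List.Relation.Unary.Any using (here; there)
open import Data.Maybe using (just; nothing)
open import Data.Nat using (suc; zero; _≡ᵇ_)
open import Data.Nat.ListAction using (sum)
open import Data.Nat.Properties using (+-commutativeSemigroup; +-identityʳ; +-suc; +-assoc; ≤-refl; ≤-trans; ≤-pred; n≤1+n; ≤∧≢⇒<; m+n≤o⇒m≤o; <-irrefl; ≡ᵇ⇒≡; ≡⇒≡ᵇ)
open import Data.Product using (_×_; _,_; proj₁; proj₂)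
open import Data.Sum using (_⊎_; inj₁; inj₂; [_,_]′)
open import Data.Unit using (⊤; tt)
open import Function using (_∘_)
open import Relation.Binary.PropositionalEquality using (refl; trans; cong; cong₂; subst; subst₂; _≢_; module ≡-Reasoning)
  renaming (sym to ≡-sym)
open import Relation.Nullary using (yes; no)

open ≡-Reasoning

sum-map-+ : ∀ {A : Set} (f g : A → ℕ) xs →
            sum (map (λ x → f x + g x) xs) ≡ sum (map f xs) + sum (map g xs)
sum-map-+ f g []       = refl
sum-map-+ f g (x ∷ xs) =
  trans (cong (f x + g x +_) (sum-map-+ f g xs))
        (interchange +-commutativeSemigroup (f x) (g x) _ _)

insertBy-↭ : ∀ {A : Set} (lt : A → A → Bool) x ys → insertBy lt x ys ↭ x ∷ ys
insertBy-↭ lt x []       = ↭-refl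
insertBy-↭ lt x (y ∷ ys) with lt x y
... | true  = ↭-refl
... | false = ↭-trans (↭-prep y (insertBy-↭ lt x ys)) (↭-swap y x ↭-refl)

sortBy-↭ : ∀ {A : Set} (lt : A → A → Bool) xs → sortBy lt xs ↭ xs
sortBy-↭ lt []       = ↭-refl
sortBy-↭ lt (x ∷ xs) = ↭-trans (insertBy-↭ lt x (sortBy lt xs)) (↭-prep x (sortBy-↭ lt xs))

∈-PAcol : ∀ {h m} (S : Haplotypes h m) j c → c ∈ PAcol S j
∈-PAcol {h} S j c = ∈-resp-↭ (↭-sym (sortBy-↭ (before S j) (allFin h))) (∈-allFin c)

range-suc : ∀ a n → range a (suc n) ≡ a ∷ range (suc a) n
range-suc a n = cong₂ _∷_ (+-identityʳ a) (begin
  map (a +_) (applyUpTo suc n)       ≡⟨ map-applyUpTo suc (a +_) n ⟩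
  applyUpTo (λ i → a + suc i) n      ≡⟨ map-upTo (λ i → a + suc i) n ⟨
  map (λ i → a + suc i) (upTo n)     ≡⟨ map-cong (+-suc a) (upTo n) ⟩
  range (suc a) n                    ∎)

Ascending : ℕ → ℕ → List ℕ → Set
Ascending lo hi []       = ⊤
Ascending lo hi (e ∷ es) = lo ≤ e × e ≤ hi × Ascending (suc e) hi es

Ascending-weaken : ∀ {lo lo′ hi} es → lo′ ≤ lo → Ascending lo hi es → Ascending lo′ hi es
Ascending-weaken []       _     _                  = tt
Ascending-weaken (e ∷ es) lo′≤lo (lo≤e , e≤hi , r) = ≤-trans lo′≤lo lo≤e , e≤hi , r

Ascending-filter : ∀ {lo hi} (p : ℕ → Bool) es → Ascending lo hi es → Ascending lo hi (filterᵇ p es)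
Ascending-filter p []       _                  = tt
Ascending-filter p (e ∷ es) (lo≤e , e≤hi , r) with p e
... | true  = lo≤e , e≤hi , Ascending-filter p es r
... | false = Ascending-weaken (filterᵇ p es) (≤-trans lo≤e (n≤1+n e)) (Ascending-filter p es r)

Ascending-range : ∀ {hi} a n → a + n ≤ suc hi → Ascending a hi (range a n)
Ascending-range a zero    _       = tt
Ascending-range {hi} a (suc n) a+n≤hi =
  subst (Ascending a hi) (≡-sym (range-suc a n))
        (≤-refl , ≤-pred (m+n≤o⇒m≤o (suc a) bound) , Ascending-range (suc a) n bound)
  where
  bound : suc a + n ≤ suc hi
  bound = subst (_≤ suc hi) (+-suc a n) a+n≤hi

Ascending-above : ∀ {hi} es → Ascending (suc hi) hi es → es ≡ []
Ascending-above []       _                  = refl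
Ascending-above (e ∷ es) (hi<e , e≤hi , _) = ⊥-elim (<-irrefl refl (≤-trans hi<e e≤hi))

ends : List (ℕ × ℕ) → List ℕ
ends = map proj₂

ends-mkIntervals : ∀ s bs → ends (mkIntervals s bs) ≡ bs
ends-mkIntervals s []       = refl
ends-mkIntervals s (b ∷ bs) = cong (b ∷_) (ends-mkIntervals (suc b) bs)

hapIntervals-ascending : ∀ {h m} (S : Haplotypes h m) c → Ascending 1 m (ends (hapIntervals S c))
hapIntervals-ascending {m = m} S c =
  subst (Ascending 1 m) (≡-sym (ends-mkIntervals 1 (boundaries S c)))
        (Ascending-filter _ (range 1 m) (Ascending-range 1 m ≤-refl))

canonicalCount nonCanonicalCount : List Seg → ℕ
canonicalCount    = length ∘ filterᵇ canonical
nonCanonicalCount = length ∘ filterᵇ (not ∘ canonical)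

length≡canonical+nonCanonical : ∀ rs → length rs ≡ canonicalCount rs + nonCanonicalCount rs
length≡canonical+nonCanonical []       = refl
length≡canonical+nonCanonical (r ∷ rs) with canonical r
... | true  = cong suc (length≡canonical+nonCanonical rs)
... | false = trans (cong suc (length≡canonical+nonCanonical rs)) (≡-sym (+-suc _ _))

nonCanonicalCount-++ : ∀ rs rs′ → nonCanonicalCount (rs ++ rs′) ≡ nonCanonicalCount rs + nonCanonicalCount rs′
nonCanonicalCount-++ rs rs′ = trans (cong length (filter-++ _ rs rs′)) (length-++ (filterᵇ _ rs))

passive-split-preserves : ∀ rs b e rest →
  nonCanonicalCount (rs ++ [ seg b e false ]) + length rest ≡ nonCanonicalCount rs + length ((b , e) ∷ rest)
passive-split-preserves rs b e rest =
  trans (cong (_+ length rest) (nonCanonicalCount-++ rs _)) (+-assoc (nonCanonicalCount rs) 1 (length rest))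

active-split-preserves : ∀ rs b b′ j e (rest : List (ℕ × ℕ)) →
  nonCanonicalCount (rs ++ [ seg b j true ]) + length ((b′ , e) ∷ rest) ≡ nonCanonicalCount rs + length ((b , e) ∷ rest)
active-split-preserves rs b b′ j e rest =
  cong (_+ length ((b , e) ∷ rest)) (trans (nonCanonicalCount-++ rs [ seg b j true ]) (+-identityʳ _))

update-same : ∀ {h} {A : Set} (f : Fin h → A) c v → update f c v c ≡ v
update-same f c v with c ≟F c
... | yes _   = refl
... | no c≢c = ⊥-elim (c≢c refl)

update-other : ∀ {h} {A : Set} (f : Fin h → A) c v {c′} → c′ ≢ c → update f c v c′ ≡ f c′
update-other f c v {c′} c′≢c with c′ ≟F c
... | yes c′≡c = ⊥-elim (c′≢c c′≡c)
... | no _     = refl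

data StepView {h} (j : ℕ) (c : Fin h) (s : State h) : State h → Set where
  exhausted : L s c ≡ [] → StepView j c s s
  passive   : ∀ {b e rest} → L s c ≡ (b , e) ∷ rest → j ≡ e →
              StepView j c s (st (update (L s) c rest) (update (RS s) c (RS s c ++ [ seg b e false ])))
  active    : ∀ {b e rest} → L s c ≡ (b , e) ∷ rest → j ≢ e →
              StepView j c s (st (update (L s) c ((suc j , e) ∷ rest)) (update (RS s) c (RS s c ++ [ seg b j true ])))
  noSplit   : ∀ {b e rest} → L s c ≡ (b , e) ∷ rest → j ≢ e → StepView j c s s

stepView : ∀ {h} d j prev (c : Fin h) s → StepView j c s (step d j prev c s)
stepView d j prev c s with L s c in head
... | []             = exhausted head
... | (b , e) ∷ rest with j ≡ᵇ e | ≡ᵇ⇒≡ j e | ≡⇒≡ᵇ j e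
...   | true  | j≡e | _   = passive head (j≡e tt)
...   | false | _   | j≢e with prev
...     | nothing = noSplit head j≢e
...     | just c′ with countOverlaps (b , j) (RS s c′) ≡ᵇ d
...       | true  = active head j≢e
...       | false = noSplit head j≢e

Balanced : ∀ {h} → (Fin h → ℕ) → State h → Set
Balanced k s = ∀ c → nonCanonicalCount (RS s c) + length (L s c) ≡ k c

module _ {h : ℕ} (d j : ℕ) where

  step-other : ∀ prev (c : Fin h) s {c′} → c′ ≢ c →
               L (step d j prev c s) c′ ≡ L s c′ × RS (step d j prev c s) c′ ≡ RS s c′
  step-other prev c s c′≢c with step d j prev c s | stepView d j prev c s
  ... | _ | exhausted _ = refl , refl
  ... | _ | noSplit _ _ = refl , refl
  ... | _ | passive _ _ = update-other (L s) c _ c′≢c , update-other (RS s) c _ c′≢c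
  ... | _ | active _ _  = update-other (L s) c _ c′≢c , update-other (RS s) c _ c′≢c

  step-balanced-self : ∀ prev (c : Fin h) s →
    nonCanonicalCount (RS (step d j prev c s) c) + length (L (step d j prev c s) c)
      ≡ nonCanonicalCount (RS s c) + length (L s c)
  step-balanced-self prev c s with step d j prev c s | stepView d j prev c s
  ... | _ | exhausted _ = refl
  ... | _ | noSplit _ _ = refl
  ... | _ | passive {b} {e} {rest} head _
    rewrite update-same (L s) c rest | update-same (RS s) c (RS s c ++ [ seg b e false ]) | head
    = passive-split-preserves (RS s c) b e rest
  ... | _ | active {b} {e} {rest} head _
    rewrite update-same (L s) c ((suc j , e) ∷ rest) | update-same (RS s) c (RS s c ++ [ seg b j true ]) | head
    = active-split-preserves (RS s c) b (suc j) j e rest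

  step-ascending-self : ∀ {hi} prev (c : Fin h) s →
    Ascending j hi (ends (L s c)) → Ascending (suc j) hi (ends (L (step d j prev c s) c))
  step-ascending-self prev c s asc with step d j prev c s | stepView d j prev c s
  ... | _ | exhausted head rewrite head = tt
  ... | _ | noSplit head j≢e rewrite head
    with j≤e , e≤hi , r ← asc = ≤∧≢⇒< j≤e j≢e , e≤hi , r
  ... | _ | passive {rest = rest} head refl rewrite update-same (L s) c rest | head
    with _ , _ , r ← asc = r
  ... | _ | active {e = e} {rest} head j≢e rewrite update-same (L s) c ((suc j , e) ∷ rest) | head
    with j≤e , e≤hi , r ← asc = ≤∧≢⇒< j≤e j≢e , e≤hi , r

  step-balanced : ∀ {k} prev c s → Balanced k s → Balanced k (step d j prev c s)
  step-balanced prev c s bal c′ with c′ ≟F c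
  ... | yes refl = trans (step-balanced-self prev c s) (bal c)
  ... | no c′≢c with L≡ , RS≡ ← step-other prev c s c′≢c rewrite L≡ | RS≡ = bal c′

  runRows-balanced : ∀ {k} prev cs s → Balanced k s → Balanced k (runRows d j prev cs s)
  runRows-balanced prev []       s bal = bal
  runRows-balanced prev (c ∷ cs) s bal = runRows-balanced (just c) cs _ (step-balanced prev c s bal)

  runRows-ascending : ∀ {hi} prev cs s →
    (∀ c → Ascending (suc j) hi (ends (L s c)) ⊎ (c ∈ cs × Ascending j hi (ends (L s c)))) →
    ∀ c → Ascending (suc j) hi (ends (L (runRows d j prev cs s) c))
  runRows-ascending prev [] s inv c with inv c
  ... | inj₁ asc     = asc
  ... | inj₂ (() , _)
  runRows-ascending {hi} prev (c₀ ∷ cs) s inv = runRows-ascending (just c₀) cs (step d j prev c₀ s) inv′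
    where
    inv′ : ∀ c → Ascending (suc j) hi (ends (L (step d j prev c₀ s) c))
                 ⊎ (c ∈ cs × Ascending j hi (ends (L (step d j prev c₀ s) c)))
    inv′ c with c ≟F c₀
    ... | yes refl =
      inj₁ (step-ascending-self prev c s ([ Ascending-weaken _ (n≤1+n j) , proj₂ ]′ (inv c)))
    ... | no c≢c₀ rewrite proj₁ (step-other prev c₀ s c≢c₀) with inv c
    ...   | inj₁ asc              = inj₁ asc
    ...   | inj₂ (here c≡c₀ , _)  = ⊥-elim (c≢c₀ c≡c₀)
    ...   | inj₂ (there c∈cs , asc) = inj₂ (c∈cs , asc)

module _ {h m : ℕ} (S : Haplotypes h m) (d : ℕ) where

  processColumn : State h → ℕ → State h
  processColumn s j = runRows d j nothing (PAcol S j) s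

  columns-balanced : ∀ {k} s js → Balanced k s → Balanced k (foldl processColumn s js)
  columns-balanced s []       bal = bal
  columns-balanced s (j ∷ js) bal =
    columns-balanced (processColumn s j) js (runRows-balanced d j nothing (PAcol S j) s bal)

  decompose-balanced : Balanced (length ∘ hapIntervals S) (decompose S d)
  decompose-balanced = columns-balanced (initState S) (range 1 m) (λ _ → refl)

  AllAscending : ℕ → State h → Set
  AllAscending j s = ∀ c → Ascending j m (ends (L s c))

  column-ascending : ∀ j s → AllAscending j s → AllAscending (suc j) (processColumn s j)
  column-ascending j s asc =
    runRows-ascending d j nothing (PAcol S j) s (λ c → inj₂ (∈-PAcol S j c , asc c))

  columns-ascending : ∀ a n s → AllAscending a s → AllAscending (a + n) (foldl processColumn s (range a n))
  columns-ascending a zero    s asc = subst (λ b → AllAscending b s) (≡-sym (+-identityʳ a)) asc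
  columns-ascending a (suc n) s asc =
    subst₂ AllAscending (≡-sym (+-suc a n)) (cong (foldl processColumn s) (≡-sym (range-suc a n)))
           (columns-ascending (suc a) n (processColumn s a) (column-ascending a s asc))

  decompose-L-empty : ∀ c → length (L (decompose S d) c) ≡ 0
  decompose-L-empty c = trans (≡-sym (length-map proj₂ (L (decompose S d) c)))
    (cong length (Ascending-above _ (columns-ascending 1 m (initState S) (hapIntervals-ascending S) c)))

  length-RS-decompose : ∀ c → length (RS (decompose S d) c)
                              ≡ canonicalCount (RS (decompose S d) c) + length (hapIntervals S c)
  length-RS-decompose c = begin
    length rs                                  ≡⟨ length≡canonical+nonCanonical rs ⟩
    canonicalCount rs + nonCanonicalCount rs   ≡⟨ cong (canonicalCount rs +_) nonCanonical≡ ⟩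
    canonicalCount rs + length (hapIntervals S c) ∎
    where
    rs : List Seg
    rs = RS (decompose S d) c
    nonCanonical≡ : nonCanonicalCount rs ≡ length (hapIntervals S c)
    nonCanonical≡ = begin
      nonCanonicalCount rs                                   ≡⟨ +-identityʳ _ ⟨
      nonCanonicalCount rs + 0                               ≡⟨ cong (nonCanonicalCount rs +_) (decompose-L-empty c) ⟨
      nonCanonicalCount rs + length (L (decompose S d) c)    ≡⟨ decompose-balanced c ⟩
      length (hapIntervals S c)                              ∎

lemma12 : (h m : ℕ) (S : Haplotypes h m) (d : ℕ) → 1 < d → 1 ≤ m →
    totalRefined (decompose S d) ≡ totalCanonical (decompose S d) + totalHapIntervals S
lemma12 h m S d _ _ = begin
  totalRefined (decompose S d)
    ≡⟨ cong sum (map-cong (length-RS-decompose S d) (allFin h)) ⟩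
  sum (map (λ c → canonicalCount (RS (decompose S d) c) + length (hapIntervals S c)) (allFin h))
    ≡⟨ sum-map-+ _ _ (allFin h) ⟩
  totalCanonical (decompose S d) + totalHapIntervals S ∎
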